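{- Every graph $G$ satisfies ${\rm tw}(G)+1 \le {\rm tree}\text{ - }\alpha(G)^2\cdot {\rm tree}\text{ - }\chi(G)$.
   Context: A tree-decomposition of a graph $G$ is a pair $(T,\{X_t\}_{t\in V(T)})$ where $T$ is a tree and $X_t\subseteq V(G)$, such that every edge of $G$ has both ends in some $X_t$ and for every vertex $v$ the nodes $t$ with $v\in X_t$ induce a non-empty connected subtree of $T$. ${\rm tw}(G)$ is the minimum over tree-decompositions of $\max_t|X_t|-1$. ${\rm tree}\text{ - }\alpha(G)$ (resp. ${\rm tree}\text{ - }\chi(G)$) is the minimum over tree-decompositions of $G$ of $\max_t \alpha(G[X_t])$ (resp. $\max_t\chi(G[X_t])$), where $\alpha$ is the independence number and $\chi$ the chromatic number. -}

module Defs where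

open import Data.Nat using (ℕ; suc; _≤_; _*_; _^_)
open import Data.Fin using (Fin)
open import Data.Fin.Subset using (Subset; _∈_; _⊆_; ∣_∣)
open import Data.List using (List; []; _∷_; _++_; length)
open import Data.List.Relation.Unary.Unique.Propositional using (Unique)
open import Data.Product using (Σ; ∃; _×_; _,_)
open import Data.Unit using (⊤)
open import Relation.Nullary using (¬_)
open import Relation.Binary.PropositionalEquality using (_≡_; _≢_)

record Graph : Set₁ where
  field
    n       : ℕ
    Adj     : Fin n → Fin n → Set
    sym     : ∀ {u v} → Adj u v → Adj v u
    irrefl  : ∀ {u} → ¬ Adj u u
open Graph public

data Walk {m : ℕ} (E : Fin m → Fin m → Set) (P : Fin m → Set) : Fin m → Fin m → Set where
  nil  : ∀ {s} → P s → Walk E P s s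
  cons : ∀ {s u t} → P s → E s u → Walk E P u t → Walk E P s t

Chain : {m : ℕ} → (Fin m → Fin m → Set) → List (Fin m) → Set
Chain E []            = ⊤
Chain E (x ∷ [])      = ⊤
Chain E (x ∷ y ∷ xs)  = E x y × Chain E (y ∷ xs)

HasCycle : {m : ℕ} → (Fin m → Fin m → Set) → Set
HasCycle E = Σ _ λ x → Σ _ λ ys →
  Unique (x ∷ ys) × (2 ≤ length ys) × Chain E (x ∷ ys ++ x ∷ [])

Always : {m : ℕ} → Fin m → Set
Always _ = ⊤

record Tree : Set₁ where
  field
    k         : ℕ
    E         : Fin (suc k) → Fin (suc k) → Set
    sym       : ∀ {u v} → E u v → E v u
    irrefl    : ∀ {u} → ¬ E u u
    connected : ∀ s t → Walk E Always s t
    acyclic   : ¬ HasCycle E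
open Tree public

Node : Tree → Set
Node T = Fin (suc (k T))

record TreeDecomposition (G : Graph) : Set₁ where
  field
    tree       : Tree
    bag        : Node tree → Subset (n G)
    edge-cover : ∀ {u v} → Adj G u v → Σ (Node tree) λ t → (u ∈ bag t) × (v ∈ bag t)
    vtx-nonempty : ∀ v → Σ (Node tree) λ t → v ∈ bag t
    vtx-connected : ∀ v {s t} → v ∈ bag s → v ∈ bag t →
                    Walk (E tree) (λ r → v ∈ bag r) s t
open TreeDecomposition public

IndependentIn : (G : Graph) → Subset (n G) → Subset (n G) → Set
IndependentIn G X I = I ⊆ X × (∀ {u v} → u ∈ I → v ∈ I → ¬ Adj G u v)

IsAlpha : (G : Graph) → Subset (n G) → ℕ → Set
IsAlpha G X a = (Σ _ λ I → IndependentIn G X I × ∣ I ∣ ≡ a)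
              × (∀ I → IndependentIn G X I → ∣ I ∣ ≤ a)

ProperColouring : (G : Graph) → Subset (n G) → (c : ℕ) → (Fin (n G) → Fin c) → Set
ProperColouring G X c f = ∀ {u v} → u ∈ X → v ∈ X → Adj G u v → f u ≢ f v

IsChi : (G : Graph) → Subset (n G) → ℕ → Set
IsChi G X c = (Σ _ λ f → ProperColouring G X c f)
            × (∀ d (f : Fin (n G) → Fin d) → ProperColouring G X d f → c ≤ d)

IsMin : (ℕ → Set₁) → ℕ → Set₁
IsMin P k = P k × (∀ j → P j → k ≤ j)

IsTwPlusOne : Graph → ℕ → Set₁
IsTwPlusOne G = IsMin λ w → Σ (TreeDecomposition G) λ D → ∀ t → ∣ bag D t ∣ ≤ w

IsTreeAlpha : Graph → ℕ → Set₁
IsTreeAlpha G = IsMin λ w → Σ (TreeDecomposition G) λ D →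
  ∀ t → Σ ℕ λ a → IsAlpha G (bag D t) a × a ≤ w

IsTreeChi : Graph → ℕ → Set₁
IsTreeChi G = IsMin λ w → Σ (TreeDecomposition G) λ D →
  ∀ t → Σ ℕ λ c → IsChi G (bag D t) c × c ≤ w

{-# OPTIONS --safe #-}

-- Take decompositions D₁ with bags of independence number at most a and D₂ with bags of
-- chromatic number at most c, and a bag X of D₁. A bag Y of D₂ meets X in at most c·a vertices,
-- as each colour class of G[X ∩ Y] is independent. So D₂ restricted to X decomposes G[X] with
-- bags of size at most w = c·a, and then G[X] has an independent set of size at least |X|/w:
-- take a leaf t of the decomposition forest; if some vertex v of the bag Y t lies in no other
-- bag, all neighbours of v lie in Y t, so v extends an independent set of G[X ∖ Y t] obtained
-- by induction; otherwise t can be deleted from the forest. Hence |X| ≤ c·a·a.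

module Submission where

open import Defs
open import Data.Nat using (ℕ; zero; suc; _+_; _*_; _^_; _≤_; _<_; z≤n; s≤s; _≤?_)
open import Data.Nat.Properties using (≤-trans; ≤-reflexive; +-suc; *-suc; +-mono-≤; *-monoˡ-≤; *-monoʳ-≤; module ≤-Reasoning)
open import Data.Nat.Solver using (module +-*-Solver)
open import Data.Fin as Fin using (Fin; toℕ)
open import Data.Fin.Properties using (_≟_; any?; ∀-cons; ¬Fin0)
open import Data.Fin.Subset as Sub using (Subset; inside; outside; _∈_; _∉_; _⊆_; _⊂_; ∣_∣; _∩_; _∪_; _─_; _-_; ⁅_⁆; Nonempty; Empty)
open import Data.Fin.Subset.Properties using (_∈?_; nonempty?; Empty-unique; ∣⊥∣≡0; ∈⊤; ∉⊥; x∈⁅x⁆; x∈⁅y⁆⇒x≡y; x∈p∩q⁻; p∩q⊆p; p∩q⊆q; p─q⊆p; x∈p∧x≢y⇒x∈p-y; x∈p⇒p-x⊂p; p⊆p∪q; x∈p∪q⁻; x∈p∪q⁺; x∈p∩q⁺; ⊥⊆; p⊆q⇒∣p∣≤∣q∣; p⊂q⇒∣p∣<∣q∣)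
open import Data.Fin.Subset.Induction using (Acc; acc; ⊂-wellFounded)
open import Data.Vec.Base using ([]; _∷_; tabulate; here; there)
open import Data.Vec.Properties using (lookup∘tabulate; []=⇒lookup; lookup⇒[]=)
open import Data.List using ([]; _∷_; _++_; take)
open import Data.List.Relation.Unary.Any using (here; there; index)
open import Data.List.Relation.Unary.All.Properties using (¬Any⇒All¬)
open import Data.List.Relation.Unary.All using ([])
open import Data.List.Relation.Unary.AllPairs using ([]; _∷_)
open import Data.List.Relation.Unary.Unique.Propositional using (Unique)
open import Data.List.Relation.Unary.Unique.Propositional.Properties using (take⁺)
open import Data.List.Membership.Propositional using () renaming (_∈_ to _∈ₗ_; _∉_ to _∉ₗ_)
import Data.List.Membership.DecPropositional as DecMembership
open import Data.Product using (∃; _×_; _,_; proj₁; proj₂)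
open import Data.Sum using (_⊎_; inj₁; inj₂; map₂)
open import Data.Empty using (⊥-elim)
open import Data.Unit using (tt)
open import Function using (_∘_)
open import Relation.Nullary using (¬_; Dec; yes; no; does; ¬?)
open import Relation.Nullary.Decidable using (decidable-stable; dec-true; _×-dec_; ¬¬-excluded-middle)
open import Relation.Nullary.Negation using (¬¬-map; contradiction)
open import Relation.Binary.PropositionalEquality as ≡ using (_≡_; _≢_; refl; trans; subst; cong)

private
  variable
    m : ℕ

¬¬-Π-Fin : {P : Fin m → Set} → (∀ i → ¬ ¬ P i) → ¬ ¬ (∀ i → P i)
¬¬-Π-Fin {zero}  h k = k (⊥-elim ∘ ¬Fin0)
¬¬-Π-Fin {suc m} h k = h Fin.zero λ p₀ → ¬¬-Π-Fin (h ∘ Fin.suc) (k ∘ ∀-cons p₀)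

x∈p─q⁻ : ∀ (p q : Subset m) {x} → x ∈ p ─ q → x ∈ p × x ∉ q
x∈p─q⁻ p q x∈ = p─q⊆p p q x∈ , ∉q p q x∈
  where
  ∉q : ∀ {m} (p q : Subset m) {x} → x ∈ p ─ q → x ∉ q
  ∉q (_ ∷ p) (_ ∷ q) (there x∈) (there x∈q) = ∉q p q x∈ x∈q
  ∉q (inside  ∷ p) (inside ∷ q) () here
  ∉q (outside ∷ p) (inside ∷ q) () here

x∈p-y⁻ : ∀ (p : Subset m) y {x} → x ∈ p - y → x ∈ p × x ≢ y
x∈p-y⁻ p y x∈ with x∈p , x∉⁅y⁆ ← x∈p─q⁻ p ⁅ y ⁆ x∈ = x∈p , λ { refl → x∉⁅y⁆ (x∈⁅x⁆ y) }

∣p∣≡∣p∩q∣+∣p─q∣ : ∀ (p q : Subset m) → ∣ p ∣ ≡ ∣ p ∩ q ∣ + ∣ p ─ q ∣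
∣p∣≡∣p∩q∣+∣p─q∣ []            []            = refl
∣p∣≡∣p∩q∣+∣p─q∣ (inside  ∷ p) (inside  ∷ q) = cong suc (∣p∣≡∣p∩q∣+∣p─q∣ p q)
∣p∣≡∣p∩q∣+∣p─q∣ (inside  ∷ p) (outside ∷ q) =
  trans (cong suc (∣p∣≡∣p∩q∣+∣p─q∣ p q)) (≡.sym (+-suc ∣ p ∩ q ∣ ∣ p ─ q ∣))
∣p∣≡∣p∩q∣+∣p─q∣ (outside ∷ p) (inside  ∷ q) = ∣p∣≡∣p∩q∣+∣p─q∣ p q
∣p∣≡∣p∩q∣+∣p─q∣ (outside ∷ p) (outside ∷ q) = ∣p∣≡∣p∩q∣+∣p─q∣ p q

Empty⇒∣p∣≡0 : {p : Subset m} → Empty p → ∣ p ∣ ≡ 0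
Empty⇒∣p∣≡0 {m} p-empty = trans (cong ∣_∣ (Empty-unique p-empty)) (∣⊥∣≡0 m)

∣p─q∩r∣≤∣p∩r∣ : ∀ (p q r : Subset m) → ∣ (p ─ q) ∩ r ∣ ≤ ∣ p ∩ r ∣
∣p─q∩r∣≤∣p∩r∣ p q r = p⊆q⇒∣p∣≤∣q∣ λ x∈ →
  let x∈p─q , x∈r = x∈p∩q⁻ (p ─ q) r x∈ in x∈p∩q⁺ (p─q⊆p p q x∈p─q , x∈r)

x∈p∪⁅y⁆⁻ : ∀ (p : Subset m) y {x} → x ∈ p ∪ ⁅ y ⁆ → x ∈ p ⊎ x ≡ y
x∈p∪⁅y⁆⁻ p y = map₂ (x∈⁅y⁆⇒x≡y y) ∘ x∈p∪q⁻ p ⁅ y ⁆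

∣p∣<∣p∪⁅x⁆∣ : {p : Subset m} {x : Fin m} → x ∉ p → ∣ p ∣ < ∣ p ∪ ⁅ x ⁆ ∣
∣p∣<∣p∪⁅x⁆∣ {x = x} x∉p = p⊂q⇒∣p∣<∣q∣ (p⊆p∪q _ , x , x∈p∪q⁺ (inj₂ (x∈⁅x⁆ x)) , x∉p)

union-bound : ∀ c (K : Fin c → Subset m) {a} (Z : Subset m) →
  (∀ {v} → v ∈ Z → ∃ λ i → v ∈ K i) →
  (∀ i {W} → W ⊆ Z → W ⊆ K i → ∣ W ∣ ≤ a) →
  ∣ Z ∣ ≤ c * a
union-bound zero    K Z covered small =
  ≤-reflexive (Empty⇒∣p∣≡0 λ (_ , v∈Z) → ¬Fin0 (proj₁ (covered v∈Z)))
union-bound (suc c) K {a} Z covered small = begin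
  ∣ Z ∣                           ≡⟨ ∣p∣≡∣p∩q∣+∣p─q∣ Z (K Fin.zero) ⟩
  ∣ Z ∩ K Fin.zero ∣ + ∣ Z ─ K Fin.zero ∣
    ≤⟨ +-mono-≤ (small Fin.zero (p∩q⊆p Z _) (p∩q⊆q Z _))
                (union-bound c (K ∘ Fin.suc) (Z ─ K Fin.zero) covered′ small′) ⟩
  a + c * a                       ∎
  where
  open ≤-Reasoning
  covered′ : ∀ {v} → v ∈ Z ─ K Fin.zero → ∃ λ i → v ∈ K (Fin.suc i)
  covered′ v∈ with v∈Z , v∉K₀ ← x∈p─q⁻ Z (K Fin.zero) v∈ | covered v∈Z
  ... | Fin.zero  , v∈K₀ = contradiction v∈K₀ v∉K₀
  ... | Fin.suc i , v∈Kᵢ = i , v∈Kᵢ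
  small′ : ∀ i {W} → W ⊆ Z ─ K Fin.zero → W ⊆ K (Fin.suc i) → ∣ W ∣ ≤ a
  small′ i W⊆Z′ = small (Fin.suc i) (p─q⊆p Z _ ∘ W⊆Z′)

fibre : ∀ {c} → (Fin m → Fin c) → Fin c → Subset m
fibre f i = tabulate λ v → does (f v ≟ i)

∈-fibre : ∀ {c} (f : Fin m → Fin c) v → v ∈ fibre f (f v)
∈-fibre f v = lookup⇒[]= v _ (trans (lookup∘tabulate _ v) (dec-true (f v ≟ f v) refl))

∈-fibre⁻ : ∀ {c} {f : Fin m → Fin c} {i v} → v ∈ fibre f i → f v ≡ i
∈-fibre⁻ {f = f} {i} {v} v∈ with f v ≟ i | trans (≡.sym (lookup∘tabulate _ v)) ([]=⇒lookup v∈)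
... | yes fv≡i | _  = fv≡i
... | no _     | ()

Chain-++-through : ∀ {Edge : Fin m → Fin m → Set} {z q x} {xs} (q∈xs : q ∈ₗ xs) →
  Chain Edge (z ∷ xs) → Edge q x → Chain Edge (z ∷ take (suc (toℕ (index q∈xs))) xs ++ x ∷ [])
Chain-++-through (here refl)  (e , _)  e′ = e , e′ , tt
Chain-++-through (there q∈xs) (e , ch) e′ = e , Chain-++-through q∈xs ch e′

close-cycle : ∀ {Edge : Fin m → Fin m → Set} {t r q xs} →
  Unique (t ∷ r ∷ xs) → Chain Edge (t ∷ r ∷ xs) → q ∈ₗ xs → Edge q t → HasCycle Edge
close-cycle {t = t} {r} {xs = xs@(_ ∷ _)} unique (e , ch) q∈xs e′ =
  t , r ∷ take (suc (toℕ (index q∈xs))) xs ,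
  take⁺ (3 + toℕ (index q∈xs)) unique , s≤s (s≤s z≤n) , e , Chain-++-through q∈xs ch e′

AtMostOneNeighbour : (Fin m → Fin m → Set) → Subset m → Fin m → Set
AtMostOneNeighbour {m} Edge A t = ∃ λ (p : Fin m) → ∀ {q} → q ∈ A → Edge t q → q ≡ p

Walk-head : ∀ {Edge : Fin m → Fin m → Set} {P s r} → Walk Edge P s r → P s
Walk-head (nil ps)      = ps
Walk-head (cons ps _ _) = ps

Walk-map : ∀ {Edge : Fin m → Fin m → Set} {P Q} → (∀ {q} → P q → Q q) →
  ∀ {s r} → Walk Edge P s r → Walk Edge Q s r
Walk-map f (nil ps)      = nil (f ps)
Walk-map f (cons ps e w) = cons (f ps) e (Walk-map f w)

Walk-first-step : ∀ {Edge : Fin m → Fin m → Set} {P s r} → Walk Edge P s r → s ≢ r →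
  ∃ λ z → P z × Edge s z
Walk-first-step (nil _)                s≢r = contradiction refl s≢r
Walk-first-step (cons {u = u} _ e w) _   = u , Walk-head w , e

module Forest {Edge : Fin m → Fin m → Set}
  (Edge-sym : ∀ {u v} → Edge u v → Edge v u) (Edge-irrefl : ∀ {u} → ¬ Edge u u) where

  Edge⇒≢ : ∀ {u v} → Edge u v → v ≢ u
  Edge⇒≢ e refl = Edge-irrefl e

  -- A walk through a node t with at most one neighbour in A enters and leaves t through the same node.
  Walk-avoid : ∀ {A t P} → AtMostOneNeighbour Edge A t → (∀ {q} → P q → q ∈ A) →
    ∀ {s r} → Walk Edge P s r → s ≢ t → r ≢ t → Walk Edge (λ q → P q × q ≢ t) s r
  Walk-avoid leaf P⊆A (nil ps) s≢t _ = nil (ps , s≢t)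
  Walk-avoid {t = t} leaf P⊆A (cons {u = u} ps e w) s≢t r≢t with u ≟ t
  ... | no u≢t = cons (ps , s≢t) e (Walk-avoid leaf P⊆A w u≢t r≢t)
  Walk-avoid leaf P⊆A (cons ps e (nil _))         s≢t r≢t | yes refl = contradiction refl r≢t
  Walk-avoid (p , nbr≡p) P⊆A (cons ps e (cons _ e′ w)) s≢t r≢t | yes refl
    with refl ← trans (nbr≡p (P⊆A ps) (Edge-sym e)) (≡.sym (nbr≡p (P⊆A (Walk-head w)) e′))
    = Walk-avoid (p , nbr≡p) P⊆A w s≢t r≢t

  module _ (acyclic : ¬ HasCycle Edge) (Edge? : ∀ i j → Dec (Edge i j)) where

    open DecMembership (_≟_ {m}) using () renaming (_∈?_ to _∈ₗ?_)

    path-end-leaf : ∀ {A t} path → Unique (t ∷ path) → Chain Edge (t ∷ path) →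
      (∀ {q} → q ∈ A → Edge t q → q ∈ₗ t ∷ path) → AtMostOneNeighbour Edge A t
    path-end-leaf {t = t} [] _ _ on-path = t , λ q∈A e → on-path-[] e (on-path q∈A e)
      where
      on-path-[] : ∀ {q} → Edge t q → q ∈ₗ t ∷ [] → q ≡ t
      on-path-[] e (here q≡t) = contradiction q≡t (Edge⇒≢ e)
    path-end-leaf {t = t} (r ∷ path) unique ch on-path = r , λ q∈A e → on-path-∷ e (on-path q∈A e)
      where
      on-path-∷ : ∀ {q} → Edge t q → q ∈ₗ t ∷ r ∷ path → q ≡ r
      on-path-∷ e (here q≡t)          = contradiction q≡t (Edge⇒≢ e)
      on-path-∷ e (there (here q≡r))  = q≡r
      on-path-∷ e (there (there q∈))  = ⊥-elim (acyclic (close-cycle unique ch q∈ (Edge-sym e)))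

    -- The path is stored newest node first; U contains every node off it, so U shrinks at each step.
    extend-path : ∀ {A} t path (U : Subset m) → Acc _⊂_ U → t ∈ A →
      Unique (t ∷ path) → Chain Edge (t ∷ path) → (∀ {x} → x ∉ₗ t ∷ path → x ∈ U) →
      ∃ λ t → t ∈ A × AtMostOneNeighbour Edge A t
    extend-path {A} t path U (acc smaller) t∈A unique ch off-path∈U
      with any? (λ q → q ∈? A ×-dec Edge? t q ×-dec ¬? (q ∈ₗ? t ∷ path))
    ... | yes (q , q∈A , e , q∉path) =
      extend-path q (t ∷ path) (U - q) (smaller (x∈p⇒p-x⊂p (off-path∈U q∉path))) q∈A
        (¬Any⇒All¬ _ q∉path ∷ unique) (Edge-sym e , ch)
        (λ x∉ → x∈p∧x≢y⇒x∈p-y (off-path∈U (x∉ ∘ there)) (x∉ ∘ here))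
    ... | no stuck = t , t∈A , path-end-leaf path unique ch λ q∈A e →
      decidable-stable (_ ∈ₗ? t ∷ path) (λ q∉path → stuck (_ , q∈A , e , q∉path))

    ∃-leaf : ∀ A → Nonempty A → ∃ λ t → t ∈ A × AtMostOneNeighbour Edge A t
    ∃-leaf A (s , s∈A) = extend-path s [] Sub.⊤ (⊂-wellFounded _) s∈A ([] ∷ []) tt (λ _ → ∈⊤)

module _ (G : Graph) where

  ∣X∩Y∣≤χ*α : ∀ {X Y a c} (f : Fin (n G) → Fin c) → ProperColouring G Y c f →
    (∀ I → IndependentIn G X I → ∣ I ∣ ≤ a) → ∣ X ∩ Y ∣ ≤ c * a
  ∣X∩Y∣≤χ*α {X} {Y} {a} f proper α-max =
    union-bound _ (fibre f) (X ∩ Y) (λ {v} _ → f v , ∈-fibre f v) colour-class-small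
    where
    colour-class-small : ∀ i {W} → W ⊆ X ∩ Y → W ⊆ fibre f i → ∣ W ∣ ≤ a
    colour-class-small i W⊆X∩Y W⊆fibre = α-max _ (p∩q⊆p X Y ∘ W⊆X∩Y , λ u∈W v∈W adj →
      proper (p∩q⊆q X Y (W⊆X∩Y u∈W)) (p∩q⊆q X Y (W⊆X∩Y v∈W)) adj
        (trans (∈-fibre⁻ {f = f} (W⊆fibre u∈W)) (≡.sym (∈-fibre⁻ {f = f} (W⊆fibre v∈W)))))

  IndependentIn-∪⁅⁆ : ∀ {X Y I v} → IndependentIn G X I → X ⊆ Y → v ∈ Y →
    (∀ {u} → u ∈ I → ¬ Adj G v u) → IndependentIn G Y (I ∪ ⁅ v ⁆)
  IndependentIn-∪⁅⁆ {Y = Y} {I} {v} (I⊆X , I-indep) X⊆Y v∈Y v-isolated =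
    ∪⁅v⁆⊆Y , λ x∈ y∈ → independent (x∈p∪⁅y⁆⁻ I v x∈) (x∈p∪⁅y⁆⁻ I v y∈)
    where
    ∪⁅v⁆⊆Y : I ∪ ⁅ v ⁆ ⊆ Y
    ∪⁅v⁆⊆Y x∈ with x∈p∪⁅y⁆⁻ I v x∈
    ... | inj₁ x∈I = X⊆Y (I⊆X x∈I)
    ... | inj₂ refl = v∈Y
    independent : ∀ {x y} → x ∈ I ⊎ x ≡ v → y ∈ I ⊎ y ≡ v → ¬ Adj G x y
    independent (inj₁ x∈I) (inj₁ y∈I) = I-indep x∈I y∈I
    independent (inj₁ x∈I) (inj₂ refl) = v-isolated x∈I ∘ sym G
    independent (inj₂ refl) (inj₁ y∈I) = v-isolated y∈I
    independent (inj₂ refl) (inj₂ refl) = irrefl G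

  module _ (T : Tree) (Y : Node T → Subset (n G)) where

    -- A decomposition of G[S] over the subforest of T induced by A, which need not be connected.
    record IsDecompositionOn (A : Subset (suc (k T))) (S : Subset (n G)) : Set where
      field
        vertex-in-bag : ∀ {v} → v ∈ S → ∃ λ s → s ∈ A × v ∈ Y s
        edge-in-bag   : ∀ {u v} → u ∈ S → v ∈ S → Adj G u v → ∃ λ s → s ∈ A × u ∈ Y s × v ∈ Y s
        bags-connected : ∀ {v s r} → v ∈ S → s ∈ A → r ∈ A → v ∈ Y s → v ∈ Y r →
                         Walk (E T) (λ q → q ∈ A × v ∈ Y q) s r
    open IsDecompositionOn

    private
      other-bag : ∀ {A t v s} → v ∉ Y t → s ∈ A → v ∈ Y s → s ∈ A - t
      other-bag v∉Yt s∈A v∈Ys = x∈p∧x≢y⇒x∈p-y s∈A λ { refl → v∉Yt v∈Ys }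

    drop-bag : ∀ {A S} t → IsDecompositionOn A S → IsDecompositionOn (A - t) (S ─ Y t)
    drop-bag {A} {S} t D = record
      { vertex-in-bag  = λ v∈ → let v∈S , v∉Yt = x∈p─q⁻ S (Y t) v∈
                                    s , s∈A , v∈Ys = vertex-in-bag D v∈S
                                in s , other-bag v∉Yt s∈A v∈Ys , v∈Ys
      ; edge-in-bag    = λ u∈ v∈ adj → let u∈S , u∉Yt = x∈p─q⁻ S (Y t) u∈
                                           s , s∈A , u∈Ys , v∈Ys = edge-in-bag D u∈S (p─q⊆p S _ v∈) adj
                                       in s , other-bag u∉Yt s∈A u∈Ys , u∈Ys , v∈Ys
      ; bags-connected = λ v∈ s∈ r∈ v∈Ys v∈Yr → let v∈S , v∉Yt = x∈p─q⁻ S (Y t) v∈ in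
          Walk-map (λ (q∈A , v∈Yq) → other-bag v∉Yt q∈A v∈Yq , v∈Yq)
            (bags-connected D v∈S (p─q⊆p A _ s∈) (p─q⊆p A _ r∈) v∈Ys v∈Yr)
      }

    add-private-vertex : ∀ {A S t v I w} → IsDecompositionOn A S → (∀ s → ∣ S ∩ Y s ∣ ≤ w) →
      v ∈ S → v ∈ Y t → ¬ (∃ λ s → s ∈ A - t × v ∈ Y s) →
      IndependentIn G (S ─ Y t) I → ∣ S ─ Y t ∣ ≤ w * ∣ I ∣ →
      IndependentIn G S (I ∪ ⁅ v ⁆) × ∣ S ∣ ≤ w * ∣ I ∪ ⁅ v ⁆ ∣
    add-private-vertex {A} {S} {t} {v} {I} {w} D small v∈S v∈Yt v-private (I⊆S′ , I-indep) size =
      IndependentIn-∪⁅⁆ (I⊆S′ , I-indep) (p─q⊆p S _) v∈S v-isolated , size′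
      where
      neighbour-in-Yt : ∀ {u} → u ∈ S → Adj G v u → u ∈ Y t
      neighbour-in-Yt u∈S adj with s , s∈A , v∈Ys , u∈Ys ← edge-in-bag D v∈S u∈S adj | s ≟ t
      ... | yes refl = u∈Ys
      ... | no s≢t   = contradiction (s , x∈p∧x≢y⇒x∈p-y s∈A s≢t , v∈Ys) v-private
      v-isolated : ∀ {u} → u ∈ I → ¬ Adj G v u
      v-isolated u∈I adj with u∈S , u∉Yt ← x∈p─q⁻ S _ (I⊆S′ u∈I) = u∉Yt (neighbour-in-Yt u∈S adj)
      v∉I : v ∉ I
      v∉I v∈I = proj₂ (x∈p─q⁻ S _ (I⊆S′ v∈I)) v∈Yt
      open ≤-Reasoning
      size′ : ∣ S ∣ ≤ w * ∣ I ∪ ⁅ v ⁆ ∣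
      size′ = begin
        ∣ S ∣                     ≡⟨ ∣p∣≡∣p∩q∣+∣p─q∣ S (Y t) ⟩
        ∣ S ∩ Y t ∣ + ∣ S ─ Y t ∣ ≤⟨ +-mono-≤ (small t) size ⟩
        w + w * ∣ I ∣             ≡⟨ ≡.sym (*-suc w _) ⟩
        w * suc ∣ I ∣             ≤⟨ *-monoʳ-≤ w (∣p∣<∣p∪⁅x⁆∣ v∉I) ⟩
        w * ∣ I ∪ ⁅ v ⁆ ∣         ∎

    open Forest {Edge = E T} (Tree.sym T) (Tree.irrefl T)

    drop-leaf : ∀ {A S t} → IsDecompositionOn A S → t ∈ A → AtMostOneNeighbour (E T) A t →
      (∀ {v} → v ∈ S → v ∈ Y t → ∃ λ s → s ∈ A - t × v ∈ Y s) → IsDecompositionOn (A - t) S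
    drop-leaf {A} {S} {t} D t∈A (p , nbr≡p) shared = record
      { vertex-in-bag  = vertex-in-bag′
      ; edge-in-bag    = edge-in-bag′
      ; bags-connected = λ v∈S s∈ r∈ v∈Ys v∈Yr →
          let s∈A , s≢t = x∈p-y⁻ A t s∈
              r∈A , r≢t = x∈p-y⁻ A t r∈
          in Walk-map (λ ((q∈A , v∈Yq) , q≢t) → x∈p∧x≢y⇒x∈p-y q∈A q≢t , v∈Yq)
               (Walk-avoid (p , nbr≡p) proj₁ (bags-connected D v∈S s∈A r∈A v∈Ys v∈Yr) s≢t r≢t)
      }
      where
      -- A vertex of Y t lying in another bag lies in the bag of t's neighbour on the way there.
      parent-shares : ∀ {v} → v ∈ S → v ∈ Y t → p ∈ A - t × v ∈ Y p
      parent-shares v∈S v∈Yt with s , s∈ , v∈Ys ← shared v∈S v∈Yt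
        with s∈A , s≢t ← x∈p-y⁻ A t s∈
        with z , (z∈A , v∈Yz) , e ← Walk-first-step (bags-connected D v∈S t∈A s∈A v∈Yt v∈Ys) (s≢t ∘ ≡.sym)
        with refl ← nbr≡p z∈A e
        = x∈p∧x≢y⇒x∈p-y z∈A (Edge⇒≢ e) , v∈Yz
      vertex-in-bag′ : ∀ {v} → v ∈ S → ∃ λ s → s ∈ A - t × v ∈ Y s
      vertex-in-bag′ v∈S with s , s∈A , v∈Ys ← vertex-in-bag D v∈S | s ≟ t
      ... | yes refl = p , parent-shares v∈S v∈Ys
      ... | no s≢t   = s , x∈p∧x≢y⇒x∈p-y s∈A s≢t , v∈Ys
      edge-in-bag′ : ∀ {u v} → u ∈ S → v ∈ S → Adj G u v → ∃ λ s → s ∈ A - t × u ∈ Y s × v ∈ Y s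
      edge-in-bag′ u∈S v∈S adj with s , s∈A , u∈Ys , v∈Ys ← edge-in-bag D u∈S v∈S adj | s ≟ t
      ... | yes refl = p , proj₁ (parent-shares u∈S u∈Ys) , proj₂ (parent-shares u∈S u∈Ys)
                         , proj₂ (parent-shares v∈S v∈Ys)
      ... | no s≢t   = s , x∈p∧x≢y⇒x∈p-y s∈A s≢t , u∈Ys , v∈Ys

    independent-set : (∀ i j → Dec (E T i j)) → ∀ w A S → Acc _⊂_ A → IsDecompositionOn A S →
      (∀ s → ∣ S ∩ Y s ∣ ≤ w) → ∃ λ I → IndependentIn G S I × ∣ S ∣ ≤ w * ∣ I ∣
    independent-set E? w A S (acc smaller) D small with nonempty? A
    ... | no A-empty = Sub.⊥ , (⊥⊆ , λ u∈ → contradiction u∈ ∉⊥) ,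
          subst (_≤ _) (≡.sym (Empty⇒∣p∣≡0 S-empty)) z≤n
      where
      S-empty : Empty S
      S-empty (v , v∈S) with s , s∈A , _ ← vertex-in-bag D v∈S = A-empty (s , s∈A)
    ... | yes A-nonempty
      with t , t∈A , t-leaf ← ∃-leaf (acyclic T) E? A A-nonempty
      with any? (λ v → v ∈? S ×-dec v ∈? Y t ×-dec ¬? (any? (λ s → s ∈? A - t ×-dec v ∈? Y s)))
    ... | yes (v , v∈S , v∈Yt , v-private)
      with I , I-indep , size ← independent-set E? w (A - t) (S ─ Y t) (smaller (x∈p⇒p-x⊂p t∈A))
                                  (drop-bag t D) (λ s → ≤-trans (∣p─q∩r∣≤∣p∩r∣ S (Y t) (Y s)) (small s))
      = I ∪ ⁅ v ⁆ , add-private-vertex D small v∈S v∈Yt v-private I-indep size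
    ... | no no-private =
      independent-set E? w (A - t) S (smaller (x∈p⇒p-x⊂p t∈A)) (drop-leaf D t∈A t-leaf shared) small
      where
      shared : ∀ {v} → v ∈ S → v ∈ Y t → ∃ λ s → s ∈ A - t × v ∈ Y s
      shared {v} v∈S v∈Yt = decidable-stable (any? (λ s → s ∈? A - t ×-dec v ∈? Y s))
        (λ v-private → no-private (v , v∈S , v∈Yt , v-private))

  decomposition-on-⊤ : (D : TreeDecomposition G) (S : Subset (n G)) →
    IsDecompositionOn (tree D) (bag D) Sub.⊤ S
  decomposition-on-⊤ D S = record
    { vertex-in-bag  = λ {v} _ → let s , v∈Ys = vtx-nonempty D v in s , ∈⊤ , v∈Ys
    ; edge-in-bag    = λ _ _ adj → let s , u∈Ys , v∈Ys = edge-cover D adj in s , ∈⊤ , u∈Ys , v∈Ys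
    ; bags-connected = λ {v} _ _ _ v∈Ys v∈Yr → Walk-map (∈⊤ ,_) (vtx-connected D v v∈Ys v∈Yr)
    }

  ∣X∣≤w*α : (D : TreeDecomposition G) {X : Subset (n G)} {w a : ℕ} → (∀ s → ∣ X ∩ bag D s ∣ ≤ w) →
    (∀ I → IndependentIn G X I → ∣ I ∣ ≤ a) → ∣ X ∣ ≤ w * a
  ∣X∣≤w*α D {X} {w} {a} small α-max = decidable-stable (_ ≤? _) (¬¬-map bound E-decidable)
    where
    -- Adjacency in the tree need not be decidable, but the goal is, so it may be assumed.
    E-decidable : ¬ ¬ (∀ i j → Dec (E (tree D) i j))
    E-decidable = ¬¬-Π-Fin λ i → ¬¬-Π-Fin λ j → ¬¬-excluded-middle
    bound : (∀ i j → Dec (E (tree D) i j)) → ∣ X ∣ ≤ w * a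
    bound E? with I , I-indep , size ← independent-set (tree D) (bag D) E? w Sub.⊤ X (⊂-wellFounded _)
                                          (decomposition-on-⊤ D X) small
      = ≤-trans size (*-monoʳ-≤ w (α-max I I-indep))

proposition1p3 : (G : Graph) (tw+1 a c : ℕ) →
    IsTwPlusOne G tw+1 → IsTreeAlpha G a → IsTreeChi G c →
    tw+1 ≤ (a ^ 2) * c
proposition1p3 G tw+1 a c (_ , tw+1-min) ((D₁ , α-bags) , _) ((D₂ , χ-bags) , _) =
  tw+1-min _ (D₁ , bag-bound)
  where
  bag-bound : ∀ t → ∣ bag D₁ t ∣ ≤ (a ^ 2) * c
  bag-bound t with aₜ , (_ , α-max) , aₜ≤a ← α-bags t =
    ≤-trans (∣X∣≤w*α G D₂ overlap-bound α-max′) (≤-reflexive (rearrange a c))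
    where
    α-max′ : ∀ I → IndependentIn G (bag D₁ t) I → ∣ I ∣ ≤ a
    α-max′ I I-indep = ≤-trans (α-max I I-indep) aₜ≤a
    overlap-bound : ∀ s → ∣ bag D₁ t ∩ bag D₂ s ∣ ≤ c * a
    overlap-bound s with cₛ , ((f , proper) , _) , cₛ≤c ← χ-bags s =
      ≤-trans (∣X∩Y∣≤χ*α G f proper α-max′) (*-monoˡ-≤ a cₛ≤c)
    rearrange : ∀ a c → c * a * a ≡ (a ^ 2) * c
    rearrange = solve 2 (λ a c → c :* a :* a := (a :^ 2) :* c) refl
      where open +-*-Solver
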